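{- Let $w=w_1\cdots w_n\in\mathfrak{S}_n$ and let $w_i\cdots w_j$ be a $k$-up. Let $i\le i'<j'\le j$ be such that $w_{i'}\cdots w_{j'}$ is a $k$-up with $j'-i'$ minimal among all $k$-ups $w_{a}\cdots w_{b}$ with $i\le a<b\le j$. Then $w_{i'}\cdots w_{j'}$ is a $k$-ascending section.
   Context: Let $n\ge2$, $1\le k\le n-1$, and $\mathfrak S_n$ the permutations of $\{1,\dots,n\}$ in one-line notation $w=w_1\cdots w_n$. A section of $w$ is a consecutive segment $w_sw_{s+1}\cdots w_t$. A section $w_s\cdots w_t$ is a $k$-up if $s<t$ and $w_t-w_s\ge k$. A section $w_i\cdots w_j$ with $i<j$ is $k$-ascending if (1) $w_i=\min\{w_i,\dots,w_j\}$ and $w_j=\max\{w_i,\dots,w_j\}$; (2) $w_j-w_i\ge k$; (3) there are no $i\le s<t\le j$ with $w_s-w_t\ge k$. -}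

module Defs where

open import Data.Nat using (ℕ; _≤_; _<_; _∸_; _+_)
open import Data.Fin using (Fin; toℕ)
open import Data.Product using (_×_)
open import Relation.Nullary using (¬_)
open import Function.Bundles using (_⤖_; Bijection)

-- Values are encoded 0-based (value v stands for v+1); only differences
-- and comparisons of values are used, so this shift is immaterial.
Perm : ℕ → Set
Perm n = Fin n ⤖ Fin n

val : {n : ℕ} → Perm n → Fin n → ℕ
val w p = toℕ (Bijection.to w p)

_≤ₚ_ : {n : ℕ} → Fin n → Fin n → Set
p ≤ₚ q = toℕ p ≤ toℕ q

_<ₚ_ : {n : ℕ} → Fin n → Fin n → Set
p <ₚ q = toℕ p < toℕ q

IsKUp : {n : ℕ} → ℕ → Perm n → Fin n → Fin n → Set
IsKUp k w s t = (s <ₚ t) × (val w s + k ≤ val w t)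

IsKAscending : {n : ℕ} → ℕ → Perm n → Fin n → Fin n → Set
IsKAscending {n} k w i j =
  (i <ₚ j)
  × ((m : Fin n) → i ≤ₚ m → m ≤ₚ j → (val w i ≤ val w m) × (val w m ≤ val w j))
  × (val w i + k ≤ val w j)
  × ((s t : Fin n) → i ≤ₚ s → s <ₚ t → t ≤ₚ j → ¬ (val w t + k ≤ val w s))

-- If a value inside a shortest k-up w_x..w_y fell below w_x (or rose above
-- w_y), cutting the section there would leave a shorter k-up; so w_x and w_y
-- are the minimum and maximum of the section.  A k-descent w_s..w_t inside it
-- would then give w_x + k ≤ w_t + k ≤ w_s, making w_x..w_s a shorter k-up.
module Submission where

open import Defs
open import Data.Nat using (ℕ; _≤_; _<_; _∸_; _+_)
open import Data.Nat.Properties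
open import Data.Fin using (Fin; toℕ)
open import Data.Fin.Properties using (toℕ-injective)
open import Data.Product using (_×_; _,_; proj₁; proj₂)
open import Relation.Nullary using (¬_)
open import Relation.Binary.PropositionalEquality using (_≢_; cong)

width : {n : ℕ} → Fin n → Fin n → ℕ
width s t = toℕ t ∸ toℕ s

width-shrinkˡ : {n : ℕ} {x a b y : Fin n} →
  x <ₚ a → a ≤ₚ b → b ≤ₚ y → width a b < width x y
width-shrinkˡ {a = a} x<a a≤b b≤y =
  ≤-<-trans (∸-monoˡ-≤ (toℕ a) b≤y) (∸-monoʳ-< x<a (≤-trans a≤b b≤y))

width-shrinkʳ : {n : ℕ} {x a b y : Fin n} →
  x ≤ₚ a → a ≤ₚ b → b <ₚ y → width a b < width x y
width-shrinkʳ {y = y} x≤a a≤b b<y =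
  <-≤-trans (∸-monoˡ-< b<y a≤b) (∸-monoʳ-≤ (toℕ y) x≤a)

module _ {n : ℕ} (w : Perm n) where

  ≤ₚ∧val≢⇒<ₚ : {s t : Fin n} → s ≤ₚ t → val w s ≢ val w t → s <ₚ t
  ≤ₚ∧val≢⇒<ₚ s≤t vs≢vt = ≤∧≢⇒< s≤t (λ eq → vs≢vt (cong (val w) (toℕ-injective eq)))

  IsShortestKUp : ℕ → Fin n → Fin n → Set
  IsShortestKUp k x y =
    IsKUp k w x y ×
    ((a b : Fin n) → x ≤ₚ a → b ≤ₚ y → IsKUp k w a b → width x y ≤ width a b)

  module _ {k : ℕ} {x y : Fin n} (shortest : IsShortestKUp k x y) where

    private
      x<y : x <ₚ y
      x<y = proj₁ (proj₁ shortest)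

      rise : val w x + k ≤ val w y
      rise = proj₂ (proj₁ shortest)

      vx≤vy : val w x ≤ val w y
      vx≤vy = ≤-trans (m≤m+n _ k) rise

      no-shorter : (a b : Fin n) → x ≤ₚ a → b ≤ₚ y → IsKUp k w a b →
                   ¬ (width a b < width x y)
      no-shorter a b x≤a b≤y up shorter = <⇒≱ shorter (proj₂ shortest a b x≤a b≤y up)

    shortest-min : (m : Fin n) → x ≤ₚ m → m ≤ₚ y → val w x ≤ val w m
    shortest-min m x≤m m≤y = ≮⇒≥ vm≮vx
      where
      vm≮vx : ¬ (val w m < val w x)
      vm≮vx vm<vx = no-shorter m y (<⇒≤ x<m) ≤-refl (m<y , rise′) (width-shrinkˡ x<m m≤y ≤-refl)
        where
        x<m : x <ₚ m
        x<m = ≤ₚ∧val≢⇒<ₚ x≤m (>⇒≢ vm<vx)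
        rise′ : val w m + k ≤ val w y
        rise′ = ≤-trans (+-monoˡ-≤ k (<⇒≤ vm<vx)) rise
        m<y : m <ₚ y
        m<y = ≤ₚ∧val≢⇒<ₚ m≤y (<⇒≢ (<-≤-trans vm<vx vx≤vy))

    shortest-max : (m : Fin n) → x ≤ₚ m → m ≤ₚ y → val w m ≤ val w y
    shortest-max m x≤m m≤y = ≮⇒≥ vy≮vm
      where
      vy≮vm : ¬ (val w y < val w m)
      vy≮vm vy<vm = no-shorter x m ≤-refl (<⇒≤ m<y) (x<m , rise′) (width-shrinkʳ ≤-refl x≤m m<y)
        where
        m<y : m <ₚ y
        m<y = ≤ₚ∧val≢⇒<ₚ m≤y (>⇒≢ vy<vm)
        rise′ : val w x + k ≤ val w m
        rise′ = ≤-trans rise (<⇒≤ vy<vm)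
        x<m : x <ₚ m
        x<m = ≤ₚ∧val≢⇒<ₚ x≤m (<⇒≢ (≤-<-trans vx≤vy vy<vm))

    shortest-no-descent : 1 ≤ k → (s t : Fin n) → x ≤ₚ s → s <ₚ t → t ≤ₚ y →
                          ¬ (val w t + k ≤ val w s)
    shortest-no-descent k≥1 s t x≤s s<t t≤y descent =
      no-shorter x s ≤-refl (<⇒≤ s<y) (x<s , rise′) (width-shrinkʳ ≤-refl x≤s s<y)
      where
      s<y : s <ₚ y
      s<y = <-≤-trans s<t t≤y
      vx≤vt : val w x ≤ val w t
      vx≤vt = shortest-min t (≤-trans x≤s (<⇒≤ s<t)) t≤y
      rise′ : val w x + k ≤ val w s
      rise′ = ≤-trans (+-monoˡ-≤ k vx≤vt) descent
      x<s : x <ₚ s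
      x<s = ≤ₚ∧val≢⇒<ₚ x≤s (<⇒≢ (≤-<-trans vx≤vt (<-≤-trans (m<m+n _ k≥1) descent)))

    shortest⇒kAscending : 1 ≤ k → IsKAscending k w x y
    shortest⇒kAscending k≥1 =
        x<y
      , (λ m x≤m m≤y → shortest-min m x≤m m≤y , shortest-max m x≤m m≤y)
      , rise
      , shortest-no-descent k≥1

lemma2p5 : (n : ℕ) → 2 ≤ n → (k : ℕ) → 1 ≤ k → k ≤ n ∸ 1 →
    (w : Perm n) → (i j : Fin n) → IsKUp k w i j →
    (i' j' : Fin n) → i ≤ₚ i' → j' ≤ₚ j → IsKUp k w i' j' →
    ((a b : Fin n) → i ≤ₚ a → b ≤ₚ j → IsKUp k w a b →
       toℕ j' ∸ toℕ i' ≤ toℕ b ∸ toℕ a) →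
    IsKAscending k w i' j'
lemma2p5 n _ k k≥1 _ w i j _ i' j' i≤i' j'≤j up minimal =
  shortest⇒kAscending w shortest k≥1
  where
  shortest : IsShortestKUp w k i' j'
  shortest = up , λ a b i'≤a b≤j' →
    minimal a b (≤-trans i≤i' i'≤a) (≤-trans b≤j' j'≤j)
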